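{- Let $\mathcal{I}$ and $\mathcal{J}$ be ideals on $\omega$ with $\mathcal{J} \le_{\mathrm{KB}} \mathcal{I}$. If Player II has a winning strategy in the tallness game with respect to $\mathcal{J}$, then Player II has a winning strategy in the tallness game with respect to $\mathcal{I}$.
   Context: As usual, ideals on $\omega$ are assumed to contain all finite subsets of $\omega$ and not to contain $\omega$. For ideals $\mathcal{I}, \mathcal{J}$ on $\omega$, $\mathcal{J} \le_{\mathrm{KB}} \mathcal{I}$ (Katětov–Blass order) means there is a finite-to-one function $f \colon \omega \to \omega$ such that $f^{ -1}(J) \in \mathcal{I}$ for every $J \in \mathcal{J}$. For an ideal $\mathcal{I}$ on $\omega$, the tallness game with respect to $\mathcal{I}$ is: in round $k$ Player I plays $n_k \in \omega$, subject to $n_0 < n_1 < \cdots$, and then Player II plays $i_k \in \{0,1\}$; Player II wins if $\{n_k : k \in \omega, i_k = 1\}$ is an infinite member of $\mathcal{I}$; otherwise Player I wins. -}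

module Defs where

open import Data.Nat using (ℕ; suc; _<_; _≤_)
open import Data.Bool using (Bool; true)
open import Data.List using (List; map; upTo)
open import Data.Product using (Σ; ∃; _×_)
open import Data.Sum using (_⊎_)
open import Data.Unit using (⊤)
open import Relation.Nullary using (¬_)
open import Relation.Binary.PropositionalEquality using (_≡_)

Subset : Set₁
Subset = ℕ → Set

_⊆_ : Subset → Subset → Set
A ⊆ B = ∀ n → A n → B n

_∪_ : Subset → Subset → Subset
(A ∪ B) n = A n ⊎ B n

Whole : Subset
Whole _ = ⊤

Finite : Subset → Set
Finite A = ∃ λ N → ∀ n → A n → n < N

Infinite : Subset → Set
Infinite A = ∀ N → ∃ λ n → N ≤ n × A n

record Ideal : Set₁ where
  field
    mem        : Subset → Set
    downward   : ∀ {A B} → A ⊆ B → mem B → mem A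
    union      : ∀ {A B} → mem A → mem B → mem (A ∪ B)
    finite     : ∀ {A} → Finite A → mem A
    proper     : ¬ mem Whole
open Ideal public

FiniteToOne : (ℕ → ℕ) → Set
FiniteToOne f = ∀ m → Finite (λ n → f n ≡ m)

_≤KB_ : Ideal → Ideal → Set₁
𝒥 ≤KB ℐ = Σ (ℕ → ℕ) λ f → FiniteToOne f ×
            (∀ (J : Subset) → mem 𝒥 J → mem ℐ (λ n → J (f n)))

StrictlyIncreasing : (ℕ → ℕ) → Set
StrictlyIncreasing n = ∀ k → n k < n (suc k)

-- A strategy for Player II: given the moves n₀,…,n_k of Player I so far
-- (as a list, n₀ first), answer i_k ∈ {0,1} (false = 0, true = 1).
StrategyII : Set
StrategyII = List ℕ → Bool

history : (ℕ → ℕ) → ℕ → List ℕ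
history n k = map n (upTo (suc k))

chosen : StrategyII → (ℕ → ℕ) → Subset
chosen σ n m = ∃ λ k → n k ≡ m × σ (history n k) ≡ true

-- Since Player II's
-- moves are determined by Player I's moves via σ, it suffices (and is
-- equivalent) to quantify over all legal move sequences of Player I.
WinningII : Ideal → StrategyII → Set
WinningII ℐ σ = ∀ (n : ℕ → ℕ) → StrictlyIncreasing n →
                  Infinite (chosen σ n) × mem ℐ (chosen σ n)

IIHasWinningStrategy : Ideal → Set
IIHasWinningStrategy ℐ = ∃ λ σ → WinningII ℐ σ

-- Let f witness 𝒥 ≤KB ℐ and let σ win the game for 𝒥. Against a play n₀ < n₁ < ⋯,
-- Player II greedily selects rounds s(0) < s(1) < ⋯ such that m_j = f(n_{s(j)}) is
-- strictly increasing (possible because f is finite-to-one, so f is eventually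
-- large), feeds m₀ < m₁ < ⋯ to σ as a play of Player I, and answers 1 in round s(j)
-- exactly when σ answers 1 to m_j. The resulting set lies in the f-preimage of σ's
-- set, which belongs to 𝒥, hence it belongs to ℐ; it is infinite because σ's set is.
module Submission where

open import Defs
open import Data.Nat using (ℕ; zero; suc; pred; _<_; _≤_; _⊔_; z≤n; s≤s; _≟_)
open import Data.Nat.Properties
open import Data.Bool using (true)
import Data.Bool as Bool
open import Data.List using (List; []; _∷_; map; upTo; applyUpTo; length)
open import Data.List.Properties using (length-map; length-upTo; map-upTo; map-cong-local)
open import Data.List.Relation.Unary.All.Properties using (applyUpTo⁺₁)
open import Data.Product using (∃; _×_; _,_; proj₁; proj₂)
open import Data.Sum using (inj₁; inj₂)
open import Function using (id; _∘_; _⇔_; mk⇔; module Equivalence)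
open import Relation.Nullary using (Dec; yes; does)
open import Relation.Nullary.Decidable using (_×-dec_; does-⇔; dec-true)
import Relation.Nullary.Decidable as Dec
open import Relation.Binary.PropositionalEquality

private
  variable
    i j k M x : ℕ
    n n' : ℕ → ℕ

strictlyIncreasing⇒< : StrictlyIncreasing n → i < j → n i < n j
strictlyIncreasing⇒< {n = n} {i = i} {j = suc j} inc i<1+j with m<1+n⇒m<n∨m≡n i<1+j
... | inj₁ i<j  = <-trans (strictlyIncreasing⇒< inc i<j) (inc j)
... | inj₂ refl = inc i

strictlyIncreasing⇒monotone : StrictlyIncreasing n → i ≤ j → n i ≤ n j
strictlyIncreasing⇒monotone inc i≤j with m≤n⇒m<n∨m≡n i≤j
... | inj₁ i<j  = <⇒≤ (strictlyIncreasing⇒< inc i<j)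
... | inj₂ refl = ≤-refl

strictlyIncreasing-reflects-≤ : StrictlyIncreasing n → n i ≤ n j → i ≤ j
strictlyIncreasing-reflects-≤ inc ni≤nj =
  ≮⇒≥ (λ j<i → <⇒≱ (strictlyIncreasing⇒< inc j<i) ni≤nj)

strictlyIncreasing⇒id≤ : StrictlyIncreasing n → ∀ k → k ≤ n k
strictlyIncreasing⇒id≤ inc zero    = z≤n
strictlyIncreasing⇒id≤ inc (suc k) = ≤-trans (s≤s (strictlyIncreasing⇒id≤ inc k)) (inc k)

module _ {f : ℕ → ℕ} (finiteToOne : FiniteToOne f) where

  threshold : ℕ → ℕ
  threshold zero    = 0
  threshold (suc M) = threshold M ⊔ proj₁ (finiteToOne M)

  <threshold : ∀ M x → f x < M → x < threshold M
  <threshold (suc M) x fx<1+M with m<1+n⇒m<n∨m≡n fx<1+M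
  ... | inj₁ fx<M  = <-≤-trans (<threshold M x fx<M) (m≤m⊔n (threshold M) _)
  ... | inj₂ fx≡M = <-≤-trans (proj₂ (finiteToOne M) x fx≡M) (m≤n⊔m (threshold M) _)

  threshold≤⇒≤ : threshold M ≤ x → M ≤ f x
  threshold≤⇒≤ {M} {x} threshold≤x = ≮⇒≥ (λ fx<M → <⇒≱ (<threshold M x fx<M) threshold≤x)

AgreeUpTo : ℕ → (ℕ → ℕ) → (ℕ → ℕ) → Set
AgreeUpTo k n n' = ∀ i → i ≤ k → n i ≡ n' i

history-cong : AgreeUpTo k n n' → history n k ≡ history n' k
history-cong {k} agree =
  map-cong-local (applyUpTo⁺₁ id (suc k) (λ {i} i<1+k → agree i (≤-pred i<1+k)))

-- Reads a history back as a sequence; the value 0 past its end is never consulted.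
at : List ℕ → ℕ → ℕ
at []       _       = 0
at (x ∷ xs) zero    = x
at (x ∷ xs) (suc i) = at xs i

at-applyUpTo : ∀ (g : ℕ → ℕ) m → i < m → at (applyUpTo g m) i ≡ g i
at-applyUpTo {zero}  g (suc m) _       = refl
at-applyUpTo {suc i} g (suc m) i<1+m = at-applyUpTo (g ∘ suc) m (≤-pred i<1+m)

at-history : ∀ n k → AgreeUpTo k (at (history n k)) n
at-history n k i i≤k = begin
  at (map n (upTo (suc k))) i ≡⟨ cong (λ l → at l i) (map-upTo n (suc k)) ⟩
  at (applyUpTo n (suc k)) i  ≡⟨ at-applyUpTo n (suc k) (s≤s i≤k) ⟩
  n i                         ∎
  where open ≡-Reasoning

length-history : ∀ n k → length (history n k) ≡ suc k
length-history n k = trans (length-map n (upTo (suc k))) (length-upTo (suc k))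

does≡true⇒ : ∀ {A : Set} (A? : Dec A) → does A? ≡ true → A
does≡true⇒ (yes a) _ = a

-- A property P n k of a play n and a round k that depends only on n₀,…,n_k is
-- realised by a strategy answering 1 in round k exactly when P n k holds.
module CausalStrategy {P : (ℕ → ℕ) → ℕ → Set} (P? : ∀ n k → Dec (P n k))
       (causal : ∀ {k n n'} → AgreeUpTo k n n' → P n k → P n' k) where

  strategy : StrategyII
  strategy l = does (P? (at l) (pred (length l)))

  strategy-history : ∀ n k → strategy (history n k) ≡ does (P? n k)
  strategy-history n k = begin
    does (P? (at h) (pred (length h))) ≡⟨ cong (does ∘ P? (at h) ∘ pred) (length-history n k) ⟩
    does (P? (at h) k)                 ≡⟨ does-⇔ same-answer (P? (at h) k) (P? n k) ⟩
    does (P? n k)                      ∎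
    where
    open ≡-Reasoning
    h = history n k
    agree = at-history n k
    agree⁻¹ : AgreeUpTo k n (at h)
    agree⁻¹ i i≤k = sym (agree i i≤k)
    same-answer : P (at h) k ⇔ P n k
    same-answer = mk⇔ (causal agree) (causal agree⁻¹)

  chosen-strategy : ∀ n x → chosen strategy n x ⇔ ∃ λ k → n k ≡ x × P n k
  chosen-strategy n x = mk⇔
    (λ (k , nk≡x , answer) →
      k , nk≡x , does≡true⇒ (P? n k) (trans (sym (strategy-history n k)) answer))
    (λ (k , nk≡x , p) →
      k , nk≡x , trans (strategy-history n k) (dec-true (P? n k) p))

module ThinnedStrategy {f : ℕ → ℕ} (finiteToOne : FiniteToOne f) (σ : StrategyII) where

  index : (ℕ → ℕ) → ℕ → ℕ
  thinned : (ℕ → ℕ) → ℕ → ℕ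

  index n zero    = 0
  index n (suc j) = suc (index n j) ⊔ threshold finiteToOne (suc (thinned n j))

  thinned n j = f (n (index n j))

  index-increasing : ∀ n → StrictlyIncreasing (index n)
  index-increasing n j = m≤m⊔n (suc (index n j)) (threshold finiteToOne (suc (thinned n j)))

  thinned-increasing : StrictlyIncreasing n → StrictlyIncreasing (thinned n)
  thinned-increasing {n} inc j = threshold≤⇒≤ finiteToOne (begin
    threshold finiteToOne (suc (thinned n j)) ≤⟨ m≤n⊔m (suc (index n j)) _ ⟩
    index n (suc j)                           ≤⟨ strictlyIncreasing⇒id≤ inc _ ⟩
    n (index n (suc j))                       ∎)
    where open ≤-Reasoning

  index-causal : AgreeUpTo k n n' → ∀ j → index n j ≤ k → index n j ≡ index n' j
  index-causal agree zero    _       = refl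
  index-causal {n = n} {n'} agree (suc j) index≤k =
    cong₂ (λ s y → suc s ⊔ threshold finiteToOne (suc (f y))) same (trans (agree _ below) (cong n' same))
    where
    below = ≤-trans (<⇒≤ (index-increasing n j)) index≤k
    same  = index-causal agree j below

  thinned-causal : AgreeUpTo k n n' → index n j ≡ k → AgreeUpTo j (thinned n) (thinned n')
  thinned-causal {n = n} {n'} agree refl i i≤j =
    cong f (trans (agree _ below) (cong n' (index-causal agree i below)))
    where below = strictlyIncreasing⇒monotone (index-increasing n) i≤j

  Selected : (ℕ → ℕ) → ℕ → Set
  Selected n k = ∃ λ j → index n j ≡ k × σ (history (thinned n) j) ≡ true

  -- A witness j satisfies j ≤ index n j = k, so the search for it is bounded.
  selected? : ∀ n k → Dec (Selected n k)
  selected? n k = Dec.map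
    (mk⇔ (λ { (j , _ , s) → j , s }) (λ (j , index≡k , s) → j , bound j index≡k , index≡k , s))
    (anyUpTo? (λ j → index n j ≟ k ×-dec σ (history (thinned n) j) Bool.≟ true) (suc k))
    where bound : ∀ j → index n j ≡ k → j < suc k
          bound j refl = s≤s (strictlyIncreasing⇒id≤ (index-increasing n) j)

  selected-causal : AgreeUpTo k n n' → Selected n k → Selected n' k
  selected-causal agree (j , index≡k , answer) =
    j , trans (sym (index-causal agree j (≤-reflexive index≡k))) index≡k
      , trans (cong σ (sym (history-cong (thinned-causal agree index≡k)))) answer

  open CausalStrategy selected? selected-causal public

  chosen⊆preimage : ∀ n → chosen strategy n ⊆ (λ x → chosen σ (thinned n) (f x))
  chosen⊆preimage n x ch with Equivalence.to (chosen-strategy n x) ch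
  ... | k , refl , (j , refl , answer) = j , refl , answer

  chosen-infinite : StrictlyIncreasing n → Infinite (chosen σ (thinned n)) →
                    Infinite (chosen strategy n)
  chosen-infinite {n} inc infinite N with infinite (thinned n N)
  ... | _ , mN≤mj , (j , refl , answer) =
    n (index n j) , N≤x ,
    Equivalence.from (chosen-strategy n _) (index n j , refl , j , refl , answer)
    where
    open ≤-Reasoning
    N≤x = begin
      N               ≤⟨ strictlyIncreasing-reflects-≤ (thinned-increasing inc) mN≤mj ⟩
      j               ≤⟨ strictlyIncreasing⇒id≤ (index-increasing n) j ⟩
      index n j       ≤⟨ strictlyIncreasing⇒id≤ inc (index n j) ⟩
      n (index n j)   ∎

proposition6p3 : (ℐ 𝒥 : Ideal) → 𝒥 ≤KB ℐ →
    IIHasWinningStrategy 𝒥 → IIHasWinningStrategy ℐ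
proposition6p3 ℐ 𝒥 (f , finiteToOne , preimage∈ℐ) (σ , σ-wins) = strategy , τ-wins
  where
  open ThinnedStrategy finiteToOne σ
  τ-wins : WinningII ℐ strategy
  τ-wins n inc with σ-wins (thinned n) (thinned-increasing inc)
  ... | infinite , ∈𝒥 =
    chosen-infinite inc infinite , ℐ .downward (chosen⊆preimage n) (preimage∈ℐ _ ∈𝒥)
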